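{- Let $\mathbf{s}$ be a standard episturmian word over a finite alphabet $\mathcal{A}$ whose directive word is $\Delta(\mathbf{s})=x_1x_2x_3\cdots=y_1^{d_1}y_2^{d_2}y_3^{d_3}\cdots$, where $x_i,y_i\in\mathcal{A}$, $d_i\ge 1$ are integers and $y_i\neq y_{i+1}$ for all $i\ge 1$. For $m\ge 1$ put $g(m)=d_1+\cdots+d_{m-1}+1$. Then the Ziv-Lempel factorization $z(\mathbf{s})=(z_1,z_2,\ldots)$ of $\mathbf{s}$ is given by $z_1=x_1$ and $$z_k=y_{k-1}^{ -1}\big(\overline{h_{g(k-1)-1}}\big)^{d_{k-1}}y_k\qquad\text{for all }k\ge 2.$$
   Context: Words: for words $u,w$ with $w=uv$ write $u^{ -1}w=v$; $\overline{w}$ denotes the reversal of $w$ (for $w=w_1\cdots w_n$, $\overline w=w_n\cdots w_1$); $w$ is a palindrome if $w=\overline w$. An infinite word is episturmian if its set of factors is closed under reversal and for each length $\ell$ it has at most one right special factor of length $\ell$; it is standard if all its left special factors are prefixes of it. For a word $w$, $w^{(+)}$ is the shortest palindrome having $w$ as a prefix. If $u_1=\varepsilon,u_2,u_3,\ldots$ is the sequence of palindromic prefixes of a standard episturmian word $\mathbf{s}$ (in increasing length), there is an infinite word $\Delta(\mathbf{s})=x_1x_2\cdots$ (its directive word) with $u_{n+1}=(u_nx_n)^{(+)}$ for all $n\ge1$; $\mathbf s$ is the infinite word having every $u_n$ as a prefix. For $a\in\mathcal A$ let $\psi_a$ be the morphism with $\psi_a(a)=a$ and $\psi_a(x)=ax$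 for $x\neq a$; let $\mu_0=\mathrm{Id}$, $\mu_n=\psi_{x_1}\cdots\psi_{x_n}$, and $h_n=\mu_n(x_{n+1})$ for $n\ge 0$. (Known: $u_{n+1}=h_{n-1}u_n$ for $n\ge1$.) Ziv-Lempel factorization: the z-factorization of an infinite word $\mathbf{w}$ is $z(\mathbf{w})=(z_1,z_2,\ldots)$ with $\mathbf w=z_1z_2\cdots$, where each $z_m$ is the shortest prefix of $z_mz_{m+1}\cdots$ which occurs only once (as a factor) in the word $z_1\cdots z_m$. -}

module Defs where

open import Data.Nat using (ℕ; zero; suc; _+_; _∸_; _≤_; _<_)
open import Data.Fin using (Fin)
open import Data.Fin.Properties using (_≟_)
open import Data.List using (List; []; _∷_; _++_; reverse; length; take; drop; concatMap)
open import Data.Product using (Σ; _×_; ∃; _,_)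
open import Relation.Binary.PropositionalEquality using (_≡_)
open import Relation.Nullary using (¬_; yes; no)

-- Alphabet: a finite alphabet, taken to be Fin k.
-- Finite words are lists; infinite words are functions ℕ → A
-- (position 0 is the first letter).

InfWord : ℕ → Set
InfWord k = ℕ → Fin k

module _ {k : ℕ} where

  private A = Fin k

  pref : ℕ → InfWord k → List A
  pref zero    s = []
  pref (suc n) s = s 0 ∷ pref n (λ i → s (suc i))

  shift : ℕ → InfWord k → InfWord k
  shift p s = λ i → s (p + i)

  IsPrefix : List A → List A → Set
  IsPrefix w p = ∃ λ t → w ++ t ≡ p

  Palindrome : List A → Set
  Palindrome w = reverse w ≡ w

  IsPalClosure : List A → List A → Set
  IsPalClosure w p =
    Palindrome p × IsPrefix w p ×
    (∀ q → Palindrome q → IsPrefix w q → length p ≤ length q)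

  Factor : List A → InfWord k → Set
  Factor w s = ∃ λ i → pref (length w) (shift i s) ≡ w

  RightSpecial : List A → InfWord k → Set
  RightSpecial w s = Σ A λ a → Σ A λ b →
    ¬ a ≡ b × Factor (w ++ a ∷ []) s × Factor (w ++ b ∷ []) s

  LeftSpecial : List A → InfWord k → Set
  LeftSpecial w s = Σ A λ a → Σ A λ b →
    ¬ a ≡ b × Factor (a ∷ w) s × Factor (b ∷ w) s

  Episturmian : InfWord k → Set
  Episturmian s =
    (∀ w → Factor w s → Factor (reverse w) s) ×
    (∀ u v → length u ≡ length v → RightSpecial u s → RightSpecial v s → u ≡ v)

  Standard : InfWord k → Set
  Standard s = ∀ w → LeftSpecial w s → pref (length w) s ≡ w

  StandardEpisturmian : InfWord k → Set
  StandardEpisturmian s = Episturmian s × Standard s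

  -- x (indexed from 1; x 0 unused) is the directive word of s:
  -- u 1 = ε, u 2, u 3, … is the sequence of palindromic prefixes of s
  -- (every u n is a prefix of s, every palindromic prefix of s is some u n)
  -- and u (n+1) = (u n x n)^(+) for all n ≥ 1.
  DirectiveWord : InfWord k → (ℕ → A) → Set
  DirectiveWord s x = Σ (ℕ → List A) λ u →
    (u 1 ≡ []) ×
    (∀ n → 1 ≤ n → IsPalClosure (u n ++ x n ∷ []) (u (suc n))) ×
    (∀ n → 1 ≤ n → pref (length (u n)) s ≡ u n) ×
    (∀ m → Palindrome (pref m s) → Σ ℕ λ n → 1 ≤ n × u n ≡ pref m s)

  ψ : A → List A → List A
  ψ a = concatMap (λ c → f c (a ≟ c))
    where
    f : (c : A) → _ → List A
    f c (yes _) = c ∷ []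
    f c (no _)  = a ∷ c ∷ []

  μ : (ℕ → A) → ℕ → List A → List A
  μ x zero    w = w
  μ x (suc n) w = μ x n (ψ (x (suc n)) w)

  h : (ℕ → A) → ℕ → List A
  h x n = μ x n (x (suc n) ∷ [])

  Occ : List A → List A → ℕ → Set
  Occ w v i = (i + length w ≤ length v) × (take (length w) (drop i v) ≡ w)

  OccursOnce : List A → List A → Set
  OccursOnce w v = Σ ℕ λ i → Occ w v i × (∀ j → Occ w v j → j ≡ i)

  pos : (ℕ → List A) → ℕ → ℕ
  pos z zero          = 0
  pos z (suc zero)    = 0
  pos z (suc (suc m)) = pos z (suc m) + length (z (suc m))

  -- z (indexed from 1; z 0 unused) is the Ziv–Lempel factorization of s:
  -- s = z1 z2 ⋯ and each z m is the shortest (nonempty) prefix of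
  -- z m z (m+1) ⋯ occurring only once as a factor in z1 ⋯ z m.
  IsZFactorization : InfWord k → (ℕ → List A) → Set
  IsZFactorization s z = ∀ m → 1 ≤ m →
    let p = pos z m ; ℓ = length (z m) in
    (1 ≤ ℓ) ×
    (z m ≡ pref ℓ (shift p s)) ×
    OccursOnce (z m) (pref (p + ℓ) s) ×
    (∀ ℓ′ → 1 ≤ ℓ′ → ℓ′ < ℓ →
       ¬ OccursOnce (pref ℓ′ (shift p s)) (pref (p + ℓ′) s))

dsum : (ℕ → ℕ) → ℕ → ℕ
dsum d zero          = 0
dsum d (suc zero)    = 0
dsum d (suc (suc m)) = dsum d (suc m) + d (suc m)

g : (ℕ → ℕ) → ℕ → ℕ
g d m = dsum d m + 1

-- Justin's formula Pal(a w) = ψ_a(Pal w) a gives u_{n+1} = h_{n-1} u_n = u_n h̄_{n-1}, and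
-- h_n = h_{n-1} whenever x_n = x_{n+1}.  So across the block y_k^{d_k} the palindromic prefix
-- u_{g(k)} is extended by d_k copies of H = h̄_{g(k)-1}, a word starting with y_k, and the
-- resulting prefix V = u_{g(k+1)} has period |H|.  Hence every proper prefix of
-- z_{k+1} = y_k⁻¹ H^{d_k} y_{k+1} already occurs |H| positions earlier, while z_{k+1} itself
-- does not: an earlier occurrence would place t y_{k+1}, where H = y_k t, inside the periodic
-- word V, whose windows of length |H| all contain as many letters y_{k+1} as y_k t does.

module Submission where

open import Defs
open import Data.Empty using (⊥-elim)
open import Data.Fin using (Fin)
open import Data.Fin.Properties using (_≟_)
open import Data.List
  using (List; []; _∷_; _++_; _∷ʳ_; [_]; reverse; length; take; drop; filter; concat; replicate)
open import Data.List.Properties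
  using ( ∷-injective; ∷-injectiveˡ; ∷-injectiveʳ; ++-assoc; ++-identityʳ; ++-cancelˡ; ∷ʳ-++
        ; length-++; length-++-≤ˡ; length-take; length-reverse; take-all; take-take; take-drop
        ; take-[]; drop-drop; take++drop≡id; filter-++; filter-accept; filter-reject
        ; reverse-++; reverse-involutive; unfold-reverse; concatMap-++; ≡-dec)
open import Data.Nat using (ℕ; zero; suc; pred; _+_; _∸_; _≤_; _<_; z≤n; s≤s; >-nonZero)
open import Data.Nat.Properties hiding (_≟_)
open import Data.Product using (Σ; _×_; ∃-syntax; _,_; proj₁; proj₂)
open import Data.Sum using (_⊎_; inj₁; inj₂; [_,_]′; swap)
open import Data.Unit using (⊤; tt)
open import Function using (_∘_)
open import Relation.Binary.PropositionalEquality hiding ([_])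
open import Relation.Nullary using (¬_; Dec; yes; no)

module _ {A : Set} where

  ++-split : (xs ys us vs : List A) → xs ++ ys ≡ us ++ vs → length xs ≤ length us →
             ∃[ ms ] us ≡ xs ++ ms × ys ≡ ms ++ vs
  ++-split []       ys us       vs eq _ = us , refl , eq
  ++-split (x ∷ xs) ys (u ∷ us) vs eq (s≤s xs≤us) with ∷-injective eq
  ... | refl , eq′ with ++-split xs ys us vs eq′ xs≤us
  ...   | ms , refl , ys≡ = ms , refl , ys≡

  take-length-++ : (xs ys : List A) → take (length xs) (xs ++ ys) ≡ xs
  take-length-++ []       ys = refl
  take-length-++ (x ∷ xs) ys = cong (x ∷_) (take-length-++ xs ys)

  drop-length-++ : (xs ys : List A) → drop (length xs) (xs ++ ys) ≡ ys
  drop-length-++ []       ys = refl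
  drop-length-++ (x ∷ xs) ys = drop-length-++ xs ys

  take-++-≤ : ∀ n (xs ys : List A) → n ≤ length xs → take n (xs ++ ys) ≡ take n xs
  take-++-≤ zero    xs       ys _         = refl
  take-++-≤ (suc n) (x ∷ xs) ys (s≤s n≤) = cong (x ∷_) (take-++-≤ n xs ys n≤)

  take-drop-++-≤ : ∀ m n (xs ys : List A) → m + n ≤ length xs →
                   take n (drop m (xs ++ ys)) ≡ take n (drop m xs)
  take-drop-++-≤ zero    n xs       ys le       = take-++-≤ n xs ys le
  take-drop-++-≤ (suc m) n (x ∷ xs) ys (s≤s le) = take-drop-++-≤ m n xs ys le

  take-drop-take : ∀ m n N (xs : List A) → m + n ≤ N →
                   take n (drop m (take N xs)) ≡ take n (drop m xs)
  take-drop-take zero    n N       xs       le =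
    trans (take-take n N xs) (cong (λ i → take i xs) (m≤n⇒m⊓n≡m le))
  take-drop-take (suc m) n (suc N) []       le = refl
  take-drop-take (suc m) n (suc N) (x ∷ xs) (s≤s le) = take-drop-take m n N xs le

  take-drop-++ʳ : ∀ j (us ws xs : List A) → take (length (us ++ ws)) (drop j xs) ≡ us ++ ws →
                  take (length ws) (drop (j + length us) xs) ≡ ws
  take-drop-++ʳ j us ws xs occurs = begin
    take (length ws) (drop (j + length us) xs)          ≡⟨ cong (take (length ws)) (drop-drop j (length us) xs) ⟨
    take (length ws) (drop (length us) (drop j xs))     ≡⟨ take-drop (length ws) (length us) (drop j xs) ⟩
    drop (length us) (take (length us + length ws) (drop j xs))
                                  ≡⟨ cong (λ n → drop (length us) (take n (drop j xs))) (length-++ us) ⟨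
    drop (length us) (take (length (us ++ ws)) (drop j xs)) ≡⟨ cong (drop (length us)) occurs ⟩
    drop (length us) (us ++ ws)                         ≡⟨ drop-length-++ us ws ⟩
    ws                                                  ∎
    where open ≡-Reasoning

  take-+ : ∀ m n (xs : List A) → take (m + n) xs ≡ take m xs ++ take n (drop m xs)
  take-+ zero    n xs       = refl
  take-+ (suc m) n []       = sym (take-[] n)
  take-+ (suc m) n (x ∷ xs) = cong (x ∷_) (take-+ m n xs)

  drop-∷ : ∀ i (xs : List A) → i < length xs → ∃[ y ] ∃[ ys ] drop i xs ≡ y ∷ ys
  drop-∷ zero    (x ∷ xs) _         = x , xs , refl
  drop-∷ (suc i) (x ∷ xs) (s≤s i<) = drop-∷ i xs i<

  length-take≤ : ∀ n (xs : List A) → length (take n xs) ≤ length xs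
  length-take≤ n xs = subst (_≤ length xs) (sym (length-take n xs)) (m⊓n≤n n (length xs))

  length-take≤n : ∀ n (xs : List A) → length (take n xs) ≤ n
  length-take≤n n xs = subst (_≤ n) (sym (length-take n xs)) (m⊓n≤m n (length xs))

  length-∷ʳ : ∀ (xs : List A) x → length (xs ∷ʳ x) ≡ suc (length xs)
  length-∷ʳ xs x = trans (length-++ xs) (+-comm (length xs) 1)

  ∷-drop-1 : ∀ {xs ys : List A} {c} → xs ≡ c ∷ ys → xs ≡ c ∷ drop 1 xs
  ∷-drop-1 refl = refl

  _^_ : List A → ℕ → List A
  w ^ n = concat (replicate n w)

  ^-suc : ∀ (w : List A) n → w ^ n ++ w ≡ w ^ suc n
  ^-suc w zero    = sym (++-identityʳ w)
  ^-suc w (suc n) = trans (++-assoc w (w ^ n) w) (cong (w ++_) (^-suc w n))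

  reverse-++-reverse : (xs ys : List A) → reverse (xs ++ reverse ys) ≡ ys ++ reverse xs
  reverse-++-reverse xs ys =
    trans (reverse-++ xs (reverse ys)) (cong (_++ reverse xs) (reverse-involutive ys))

module BoundedSearch {P : ℕ → Set} (P? : ∀ n → Dec (P n)) where

  first : ℕ → ℕ → ℕ
  first i zero    = i
  first i (suc f) with P? i
  ... | yes _ = i
  ... | no  _ = first (suc i) f

  first-satisfies : ∀ i f → P (i + f) → P (first i f)
  first-satisfies i zero    p = subst P (+-identityʳ i) p
  first-satisfies i (suc f) p with P? i
  ... | yes pi = pi
  ... | no  _  = first-satisfies (suc i) f (subst P (+-suc i f) p)

  first-minimal : ∀ i f j → i ≤ j → P j → first i f ≤ j
  first-minimal i zero    j i≤j _ = i≤j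
  first-minimal i (suc f) j i≤j p with P? i
  ... | yes _  = i≤j
  ... | no ¬pi with m≤n⇒m<n∨m≡n i≤j
  ...   | inj₁ i<j  = first-minimal (suc i) f j i<j p
  ...   | inj₂ refl = ⊥-elim (¬pi p)

module _ {k : ℕ} where

  private
    Word = List (Fin k)

  palindrome-++-short : (xs ts : Word) → Palindrome (xs ++ ts) → length ts ≤ length xs →
                        ts ≡ reverse (take (length ts) xs)
  palindrome-++-short xs ts pal ts≤xs
    with ++-split (reverse ts) (reverse xs) xs ts (trans (sym (reverse-++ xs ts)) pal)
                  (subst (_≤ length xs) (sym (length-reverse ts)) ts≤xs)
  ... | ms , xs≡ , _ = begin
    ts                                             ≡⟨ sym (reverse-involutive ts) ⟩
    reverse (reverse ts)                           ≡⟨ cong reverse (sym (take-length-++ (reverse ts) ms)) ⟩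
    reverse (take (length (reverse ts)) (reverse ts ++ ms))
                                   ≡⟨ cong₂ (λ n ws → reverse (take n ws)) (length-reverse ts) (sym xs≡) ⟩
    reverse (take (length ts) xs)                  ∎
    where open ≡-Reasoning

  palindrome-++-long : (xs ts : Word) → Palindrome (xs ++ ts) → length xs ≤ length ts →
                       ∃[ ms ] ts ≡ ms ++ reverse xs
  palindrome-++-long xs ts pal xs≤ts
    with ++-split xs ts (reverse ts) (reverse xs) (trans (sym pal) (reverse-++ xs ts))
                  (subst (length xs ≤_) (sym (length-reverse ts)) xs≤ts)
  ... | ms , _ , ts≡ = ms , ts≡

  ++-reverse-palindrome : (w : Word) → Palindrome (w ++ reverse w)
  ++-reverse-palindrome w = reverse-++-reverse w w

  ∷ʳ-++-reverse-palindrome : (w : Word) (c : Fin k) → Palindrome ((w ∷ʳ c) ++ reverse w)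
  ∷ʳ-++-reverse-palindrome w c = begin
    reverse ((w ∷ʳ c) ++ reverse w) ≡⟨ reverse-++-reverse (w ∷ʳ c) w ⟩
    w ++ reverse (w ∷ʳ c)           ≡⟨ cong (w ++_) (reverse-++ w [ c ]) ⟩
    w ++ c ∷ reverse w              ≡⟨ sym (++-assoc w [ c ] (reverse w)) ⟩
    (w ∷ʳ c) ++ reverse w           ∎
    where open ≡-Reasoning

  palindrome? : (w : Word) → Dec (Palindrome w)
  palindrome? w = ≡-dec _≟_ (reverse w) w

  ClosesAt : Word → ℕ → Set
  ClosesAt w i = Palindrome (w ++ reverse (take i w))

  private
    module Search (w : Word) = BoundedSearch (λ i → palindrome? (w ++ reverse (take i w)))

  closingIndex : Word → ℕ
  closingIndex w = Search.first w 0 (length w)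

  closure : Word → Word
  closure w = w ++ reverse (take (closingIndex w) w)

  closingIndex-minimal : ∀ w j → ClosesAt w j → closingIndex w ≤ j
  closingIndex-minimal w j = Search.first-minimal w 0 (length w) j z≤n

  closingIndex-∷ʳ : ∀ w c → closingIndex (w ∷ʳ c) ≤ length w
  closingIndex-∷ʳ w c = closingIndex-minimal (w ∷ʳ c) (length w)
    (subst (λ ws → Palindrome ((w ∷ʳ c) ++ reverse ws)) (sym (take-length-++ w [ c ]))
           (∷ʳ-++-reverse-palindrome w c))

  closure-palindrome : ∀ w → Palindrome (closure w)
  closure-palindrome w = Search.first-satisfies w 0 (length w)
    (subst (λ ws → Palindrome (w ++ reverse ws)) (sym (take-all (length w) w ≤-refl))
           (++-reverse-palindrome w))

  length-closure : ∀ w → length (closure w) ≡ length w + length (take (closingIndex w) w)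
  length-closure w = trans (length-++ w) (cong (length w +_) (length-reverse (take (closingIndex w) w)))

  length-closure-≤ : ∀ w → length (closure w) ≤ length w + length w
  length-closure-≤ w = subst (_≤ length w + length w) (sym (length-closure w))
    (+-monoʳ-≤ (length w) (length-take≤ (closingIndex w) w))

  closure-minimal : ∀ w q → Palindrome q → IsPrefix w q → length (closure w) ≤ length q
  closure-minimal w _ pal (t , refl) with ≤-total (length t) (length w)
  ... | inj₁ t≤w = begin
    length (closure w)                         ≡⟨ length-closure w ⟩
    length w + length (take (closingIndex w) w) ≤⟨ +-monoʳ-≤ (length w) (≤-trans (length-take≤n _ w) closes) ⟩
    length w + length t                        ≡⟨ length-++ w ⟨
    length (w ++ t)                            ∎
    where
    open ≤-Reasoning
    closes : closingIndex w ≤ length t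
    closes = closingIndex-minimal w (length t)
      (subst (λ ts → Palindrome (w ++ ts)) (palindrome-++-short w t pal t≤w) pal)
  ... | inj₂ w≤t = ≤-trans (length-closure-≤ w)
    (subst (length w + length w ≤_) (sym (length-++ w)) (+-monoʳ-≤ (length w) w≤t))

  closure-unique : ∀ w p → IsPalClosure w p → closure w ≡ p
  closure-unique w _ (pal , (t , refl) , min) = cong (w ++_) t₀≡t
    where
    t₀ = reverse (take (closingIndex w) w)
    lengths : length (w ++ t₀) ≡ length (w ++ t)
    lengths = ≤-antisym (closure-minimal w (w ++ t) pal (t , refl))
                        (min (closure w) (closure-palindrome w) (t₀ , refl))
    same-length : length t₀ ≡ length t
    same-length = +-cancelˡ-≡ (length w) _ _ (trans (sym (length-++ w)) (trans lengths (length-++ w)))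
    t₀≤w : length t₀ ≤ length w
    t₀≤w = subst (_≤ length w) (sym (length-reverse (take (closingIndex w) w))) (length-take≤ (closingIndex w) w)
    t≤w : length t ≤ length w
    t≤w = subst (_≤ length w) same-length t₀≤w
    t₀≡t : t₀ ≡ t
    t₀≡t = begin
      t₀                              ≡⟨ palindrome-++-short w t₀ (closure-palindrome w) t₀≤w ⟩
      reverse (take (length t₀) w)    ≡⟨ cong (λ n → reverse (take n w)) same-length ⟩
      reverse (take (length t) w)     ≡⟨ palindrome-++-short w t pal t≤w ⟨
      t                               ∎
      where open ≡-Reasoning

  -- ψʳ a is the conjugate of ψ a that puts a after, not before, each letter c ≠ a.
  ψʳ : Fin k → Word → Word
  ψʳ a []      = []
  ψʳ a (c ∷ w) with a ≟ c
  ... | yes _ = c ∷ ψʳ a w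
  ... | no  _ = c ∷ a ∷ ψʳ a w

  ψʳ-≡ : ∀ a c w → a ≡ c → ψʳ a (c ∷ w) ≡ c ∷ ψʳ a w
  ψʳ-≡ a c w a≡c with a ≟ c
  ... | yes _  = refl
  ... | no a≢c = ⊥-elim (a≢c a≡c)

  ψʳ-≢ : ∀ a c w → ¬ a ≡ c → ψʳ a (c ∷ w) ≡ c ∷ a ∷ ψʳ a w
  ψʳ-≢ a c w a≢c with a ≟ c
  ... | yes a≡c = ⊥-elim (a≢c a≡c)
  ... | no _    = refl

  ψʳ-∷ : ∀ a c w → ∃[ r ] ψʳ a (c ∷ w) ≡ c ∷ r
  ψʳ-∷ a c w with a ≟ c
  ... | yes _ = ψʳ a w , refl
  ... | no  _ = a ∷ ψʳ a w , refl

  ψʳ-++ : ∀ a u v → ψʳ a (u ++ v) ≡ ψʳ a u ++ ψʳ a v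
  ψʳ-++ a []      v = refl
  ψʳ-++ a (c ∷ u) v with a ≟ c
  ... | yes _ = cong (c ∷_) (ψʳ-++ a u v)
  ... | no  _ = cong (λ w → c ∷ a ∷ w) (ψʳ-++ a u v)

  ψ-++ : ∀ a (u v : Word) → ψ a (u ++ v) ≡ ψ a u ++ ψ a v
  ψ-++ a u v = concatMap-++ _ u v

  ψ-∷ʳ : ∀ a w → ψ a w ∷ʳ a ≡ a ∷ ψʳ a w
  ψ-∷ʳ a []      = refl
  ψ-∷ʳ a (c ∷ w) with a ≟ c
  ... | yes refl = cong (a ∷_) (ψ-∷ʳ a w)
  ... | no  _    = cong (λ u → a ∷ c ∷ u) (ψ-∷ʳ a w)

  reverse-ψ : ∀ a w → reverse (ψ a w) ≡ ψʳ a (reverse w)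
  reverse-ψ a []      = refl
  reverse-ψ a (c ∷ w) = begin
    reverse (ψ a ([ c ] ++ w))           ≡⟨ cong reverse (ψ-++ a [ c ] w) ⟩
    reverse (ψ a [ c ] ++ ψ a w)         ≡⟨ reverse-++ (ψ a [ c ]) (ψ a w) ⟩
    reverse (ψ a w) ++ reverse (ψ a [ c ]) ≡⟨ cong₂ _++_ (reverse-ψ a w) (reverse-ψ-letter c) ⟩
    ψʳ a (reverse w) ++ ψʳ a [ c ]       ≡⟨ ψʳ-++ a (reverse w) [ c ] ⟨
    ψʳ a (reverse w ∷ʳ c)                ≡⟨ cong (ψʳ a) (unfold-reverse c w) ⟨
    ψʳ a (reverse (c ∷ w))               ∎
    where
    open ≡-Reasoning
    reverse-ψ-letter : ∀ c → reverse (ψ a [ c ]) ≡ ψʳ a [ c ]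
    reverse-ψ-letter c with a ≟ c
    ... | yes _ = refl
    ... | no  _ = refl

  reverse-ψʳ : ∀ a w → reverse (a ∷ ψʳ a w) ≡ a ∷ ψʳ a (reverse w)
  reverse-ψʳ a w = begin
    reverse (a ∷ ψʳ a w)      ≡⟨ cong reverse (ψ-∷ʳ a w) ⟨
    reverse (ψ a w ∷ʳ a)      ≡⟨ reverse-++ (ψ a w) [ a ] ⟩
    a ∷ reverse (ψ a w)       ≡⟨ cong (a ∷_) (reverse-ψ a w) ⟩
    a ∷ ψʳ a (reverse w)      ∎
    where open ≡-Reasoning

  ψʳ-injective : ∀ a u v → ψʳ a u ≡ ψʳ a v → u ≡ v
  ψʳ-injective a []      []      _  = refl
  ψʳ-injective a []      (c ∷ v) eq with a ≟ c
  ψʳ-injective a []      (c ∷ v) () | yes _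
  ψʳ-injective a []      (c ∷ v) () | no  _
  ψʳ-injective a (c ∷ u) []      eq with a ≟ c
  ψʳ-injective a (c ∷ u) []      () | yes _
  ψʳ-injective a (c ∷ u) []      () | no  _
  ψʳ-injective a (c ∷ u) (c′ ∷ v) eq with a ≟ c | a ≟ c′
  ... | yes a≡c | no a≢c′ = ⊥-elim (a≢c′ (trans a≡c (∷-injectiveˡ eq)))
  ... | no a≢c | yes a≡c′ = ⊥-elim (a≢c (trans a≡c′ (sym (∷-injectiveˡ eq))))
  ... | yes _ | yes _ with ∷-injective eq
  ...   | refl , eq′ = cong (c ∷_) (ψʳ-injective a u v eq′)
  ψʳ-injective a (c ∷ u) (c′ ∷ v) eq | no _ | no _ with ∷-injective eq
  ...   | refl , eq′ = cong (c ∷_) (ψʳ-injective a u v (∷-injectiveʳ eq′))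

  ψʳ-palindrome : ∀ a w → Palindrome w → Palindrome (a ∷ ψʳ a w)
  ψʳ-palindrome a w pal = trans (reverse-ψʳ a w) (cong (λ u → a ∷ ψʳ a u) pal)

  ψʳ-palindrome⁻ : ∀ a w → Palindrome (a ∷ ψʳ a w) → Palindrome w
  ψʳ-palindrome⁻ a w pal = ψʳ-injective a _ _ (∷-injectiveʳ (trans (sym (reverse-ψʳ a w)) pal))

  ψʳ-isPrefix : ∀ a u c v → IsPrefix (u ∷ʳ c) v → IsPrefix (ψʳ a u ∷ʳ c) (ψʳ a v)
  ψʳ-isPrefix a u c _ (t , refl) with ψʳ-∷ a c t
  ... | r , ψʳct≡ = r , (begin
    (ψʳ a u ∷ʳ c) ++ r      ≡⟨ ++-assoc (ψʳ a u) [ c ] r ⟩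
    ψʳ a u ++ c ∷ r         ≡⟨ cong (ψʳ a u ++_) ψʳct≡ ⟨
    ψʳ a u ++ ψʳ a (c ∷ t)  ≡⟨ ψʳ-++ a u (c ∷ t) ⟨
    ψʳ a (u ++ c ∷ t)       ≡⟨ cong (ψʳ a) (++-assoc u [ c ] t) ⟨
    ψʳ a ((u ∷ʳ c) ++ t)    ∎)
    where open ≡-Reasoning

  ψʳ-isPrefix⁻ : ∀ a u c v → IsPrefix (ψʳ a u ∷ʳ c) (ψʳ a v) → IsPrefix (u ∷ʳ c) v
  ψʳ-isPrefix⁻ a u c [] (t , eq) with ψʳ a u | eq
  ... | []    | ()
  ... | _ ∷ _ | ()
  ψʳ-isPrefix⁻ a [] c (y ∷ v) (t , eq) with ψʳ-∷ a y v
  ... | r , ψʳyv≡ with trans eq ψʳyv≡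
  ...   | refl = v , refl
  ψʳ-isPrefix⁻ a (x ∷ u) c (y ∷ v) (t , eq) with ψʳ-∷ a x u | ψʳ-∷ a y v
  ... | r , ψʳxu≡ | r′ , ψʳyv≡
    with ∷-injectiveˡ (trans (cong (λ w → (w ∷ʳ c) ++ t) (sym ψʳxu≡)) (trans eq ψʳyv≡))
  ...   | refl with ψʳ-isPrefix⁻ a u c v (t , ++-cancelˡ (ψʳ a [ x ]) _ _ shifted)
    where
    open ≡-Reasoning
    shifted : ψʳ a [ x ] ++ ((ψʳ a u ∷ʳ c) ++ t) ≡ ψʳ a [ x ] ++ ψʳ a v
    shifted = begin
      ψʳ a [ x ] ++ ((ψʳ a u ∷ʳ c) ++ t)   ≡⟨ cong (ψʳ a [ x ] ++_) (++-assoc (ψʳ a u) [ c ] t) ⟩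
      ψʳ a [ x ] ++ (ψʳ a u ++ c ∷ t)      ≡⟨ ++-assoc (ψʳ a [ x ]) (ψʳ a u) (c ∷ t) ⟨
      (ψʳ a [ x ] ++ ψʳ a u) ++ c ∷ t      ≡⟨ cong (_++ c ∷ t) (ψʳ-++ a [ x ] u) ⟨
      ψʳ a (x ∷ u) ++ c ∷ t                ≡⟨ ++-assoc (ψʳ a (x ∷ u)) [ c ] t ⟨
      (ψʳ a (x ∷ u) ∷ʳ c) ++ t             ≡⟨ eq ⟩
      ψʳ a (x ∷ v)                         ≡⟨ ψʳ-++ a [ x ] v ⟩
      ψʳ a [ x ] ++ ψʳ a v                 ∎
  ...     | t′ , eq′ = t′ , cong (x ∷_) eq′

  EveryOther : Fin k → Word → Set
  EveryOther a []           = ⊤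
  EveryOther a (c ∷ [])     = ⊤
  EveryOther a (c ∷ c′ ∷ w) = (c ≡ a ⊎ c′ ≡ a) × EveryOther a (c′ ∷ w)

  everyOther-glue : ∀ a u b m v → EveryOther a (u ++ b ∷ m) → EveryOther a ((b ∷ m) ++ v) →
                    EveryOther a (u ++ (b ∷ m) ++ v)
  everyOther-glue a []           b m v _              right = right
  everyOther-glue a (c ∷ [])     b m v (c∨b , _)      right = c∨b , right
  everyOther-glue a (c ∷ c′ ∷ u) b m v (c∨c′ , left) right =
    c∨c′ , everyOther-glue a (c′ ∷ u) b m v left right

  everyOther-reverse : ∀ a w → EveryOther a w → EveryOther a (reverse w)
  everyOther-reverse a []           _           = tt
  everyOther-reverse a (c ∷ [])     _           = tt
  everyOther-reverse a (c ∷ c′ ∷ w) (c∨c′ , eo) = subst (EveryOther a) (sym reverse≡)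
    (everyOther-glue a (reverse w) c′ [] [ c ]
      (subst (EveryOther a) (unfold-reverse c′ w) (everyOther-reverse a (c′ ∷ w) eo))
      (swap c∨c′ , tt))
    where
    reverse≡ : reverse (c ∷ c′ ∷ w) ≡ reverse w ++ [ c′ ] ++ [ c ]
    reverse≡ = begin
      reverse (c ∷ c′ ∷ w)         ≡⟨ unfold-reverse c (c′ ∷ w) ⟩
      reverse (c′ ∷ w) ∷ʳ c        ≡⟨ cong (_∷ʳ c) (unfold-reverse c′ w) ⟩
      (reverse w ∷ʳ c′) ∷ʳ c       ≡⟨ ++-assoc (reverse w) [ c′ ] [ c ] ⟩
      reverse w ++ [ c′ ] ++ [ c ] ∎
      where open ≡-Reasoning

  everyOther-ψʳ : ∀ a u c → EveryOther a (a ∷ ψʳ a u ∷ʳ c)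
  everyOther-ψʳ a []      c = inj₁ refl , tt
  everyOther-ψʳ a (x ∷ u) c with a ≟ x
  ... | yes refl = inj₁ refl , everyOther-ψʳ a u c
  ... | no  _    = inj₁ refl , inj₂ refl , everyOther-ψʳ a u c

  EmptyOrEndsWith : Fin k → Word → Set
  EmptyOrEndsWith a w = w ≡ [] ⊎ ∃[ w′ ] w ≡ w′ ∷ʳ a

  emptyOrEndsWith-tail : ∀ a c w → EmptyOrEndsWith a (c ∷ w) → EmptyOrEndsWith a w
  emptyOrEndsWith-tail a c w (inj₁ ())
  emptyOrEndsWith-tail a c w (inj₂ ([]     , refl)) = inj₁ refl
  emptyOrEndsWith-tail a c w (inj₂ (_ ∷ w′ , refl)) = inj₂ (w′ , refl)

  palindrome-∷-emptyOrEndsWith : ∀ a w → Palindrome (a ∷ w) → EmptyOrEndsWith a w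
  palindrome-∷-emptyOrEndsWith a w pal with reverse w | trans (sym (unfold-reverse a w)) pal
  ... | []    | eq = inj₁ (sym (∷-injectiveʳ eq))
  ... | _ ∷ r | eq = inj₂ (r , sym (∷-injectiveʳ eq))

  everyOther⇒ψʳ-image : ∀ a w → EveryOther a (a ∷ w) → EmptyOrEndsWith a w → ∃[ q ] w ≡ ψʳ a q
  everyOther⇒ψʳ-image a []      _ _ = [] , refl
  everyOther⇒ψʳ-image a (c ∷ []) _ (inj₁ ())
  everyOther⇒ψʳ-image a (c ∷ []) _ (inj₂ ([] , refl)) = [ a ] , sym (ψʳ-≡ a a [] refl)
  everyOther⇒ψʳ-image a (c ∷ []) _ (inj₂ (_ ∷ [] , ()))
  everyOther⇒ψʳ-image a (c ∷ []) _ (inj₂ (_ ∷ _ ∷ _ , ()))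
  everyOther⇒ψʳ-image a (c ∷ c′ ∷ w) (_ , c∨c′ , eo) ends =
    -- the recursive calls are passed to step so that they are visibly structural
    step (a ≟ c) (everyOther⇒ψʳ-image a (c′ ∷ w)) (everyOther⇒ψʳ-image a w)
    where
    step : Dec (a ≡ c) →
           (EveryOther a (a ∷ c′ ∷ w) → EmptyOrEndsWith a (c′ ∷ w) → ∃[ q ] c′ ∷ w ≡ ψʳ a q) →
           (EveryOther a (a ∷ w) → EmptyOrEndsWith a w → ∃[ q ] w ≡ ψʳ a q) →
           ∃[ q ] c ∷ c′ ∷ w ≡ ψʳ a q
    step (yes a≡c) rec _ =
      let q , eq = rec (inj₁ refl , eo) (emptyOrEndsWith-tail a c _ ends)
      in c ∷ q , trans (cong (c ∷_) eq) (sym (ψʳ-≡ a c q a≡c))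
    step (no a≢c) _ rec =
      let c′≡a = [ (λ c≡a → ⊥-elim (a≢c (sym c≡a))) , (λ c′≡a → c′≡a) ]′ c∨c′
          q , eq = rec (subst (λ x → EveryOther a (x ∷ w)) c′≡a eo)
                       (emptyOrEndsWith-tail a c′ w (emptyOrEndsWith-tail a c _ ends))
      in c ∷ q , trans (cong₂ (λ x u → c ∷ x ∷ u) c′≡a eq) (sym (ψʳ-≢ a c q a≢c))

  length-ψʳ-++ : ∀ a u v → length (ψʳ a (u ++ v)) ≡ length (ψʳ a u) + length (ψʳ a v)
  length-ψʳ-++ a u v = trans (cong length (ψʳ-++ a u v)) (length-++ (ψʳ a u))

  length-ψ : ∀ a w → length (ψ a w) ≡ length (ψʳ a w)
  length-ψ a w = suc-injective (trans (sym (length-∷ʳ (ψ a w) a)) (cong length (ψ-∷ʳ a w)))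

  length-ψʳ-reverse : ∀ a w → length (ψʳ a (reverse w)) ≡ length (ψʳ a w)
  length-ψʳ-reverse a w = begin
    length (ψʳ a (reverse w))  ≡⟨ cong length (reverse-ψ a w) ⟨
    length (reverse (ψ a w))   ≡⟨ length-reverse (ψ a w) ⟩
    length (ψ a w)             ≡⟨ length-ψ a w ⟩
    length (ψʳ a w)            ∎
    where open ≡-Reasoning

  length-ψʳ-take≤ : ∀ a i w → length (ψʳ a (take i w)) ≤ length (ψʳ a w)
  length-ψʳ-take≤ a i w = subst (length (ψʳ a (take i w)) ≤_)
    (trans (sym (length-ψʳ-++ a (take i w) (drop i w))) (cong (length ∘ ψʳ a) (take++drop≡id i w)))
    (m≤m+n _ _)

  length-ψʳ-take-mono : ∀ a i j w → i ≤ j → length (ψʳ a (take i w)) ≤ length (ψʳ a (take j w))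
  length-ψʳ-take-mono a i j w i≤j = subst (λ u → length (ψʳ a u) ≤ length (ψʳ a (take j w)))
    (trans (take-take i j w) (cong (λ n → take n w) (m≤n⇒m⊓n≡m i≤j)))
    (length-ψʳ-take≤ a i (take j w))

  closure-minimal-ψʳ : ∀ a w q → Palindrome q → IsPrefix w q →
                       length (ψʳ a (closure w)) ≤ length (ψʳ a q)
  closure-minimal-ψʳ a w _ pal (t , refl) = begin
    length (ψʳ a (closure w))                         ≡⟨ length-ψʳ-++ a w (reverse t₀) ⟩
    length (ψʳ a w) + length (ψʳ a (reverse t₀))
                                        ≡⟨ cong (length (ψʳ a w) +_) (length-ψʳ-reverse a t₀) ⟩
    length (ψʳ a w) + length (ψʳ a t₀)                ≤⟨ +-monoʳ-≤ (length (ψʳ a w)) t₀≤t ⟩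
    length (ψʳ a w) + length (ψʳ a t)                 ≡⟨ length-ψʳ-++ a w t ⟨
    length (ψʳ a (w ++ t))                            ∎
    where
    open ≤-Reasoning
    t₀ = take (closingIndex w) w
    t₀≤t : length (ψʳ a t₀) ≤ length (ψʳ a t)
    t₀≤t with ≤-total (length t) (length w)
    ... | inj₁ t≤w = let t≡ = palindrome-++-short w t pal t≤w in
      subst (length (ψʳ a t₀) ≤_)
        (trans (sym (length-ψʳ-reverse a (take (length t) w))) (cong (length ∘ ψʳ a) (sym t≡)))
        (length-ψʳ-take-mono a (closingIndex w) (length t) w
          (closingIndex-minimal w (length t) (subst (λ u → Palindrome (w ++ u)) t≡ pal)))
    ... | inj₂ w≤t with palindrome-++-long w t pal w≤t
    ...   | m , refl = ≤-trans (length-ψʳ-take≤ a (closingIndex w) w)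
      (subst (_≤ length (ψʳ a (m ++ reverse w))) (length-ψʳ-reverse a w)
        (subst (length (ψʳ a (reverse w)) ≤_) (sym (length-ψʳ-++ a m (reverse w))) (m≤n+m _ _)))

  closure-everyOther : ∀ a u c → EveryOther a (u ∷ʳ c) → EveryOther a (closure (u ∷ʳ c))
  closure-everyOther a u c eo = subst (EveryOther a) closure≡
    (everyOther-glue a (take i w) b m C
      (subst (λ v → EveryOther a (take i w ++ v)) drop≡ (subst (EveryOther a) (sym (take++drop≡id i w)) eo))
      (subst (λ v → EveryOther a (v ++ C)) drop≡
        (subst (EveryOther a) (sym tail≡) (everyOther-reverse a w eo))))
    where
    w = u ∷ʳ c
    i = closingIndex w
    i<w : i < length w
    i<w = subst (i <_) (sym (length-∷ʳ u c)) (s≤s (closingIndex-∷ʳ u c))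
    nonempty = drop-∷ i w i<w
    b = proj₁ nonempty
    m = proj₁ (proj₂ nonempty)
    drop≡ : drop i w ≡ b ∷ m
    drop≡ = proj₂ (proj₂ nonempty)
    C = reverse (take i w)
    split≡ : take i w ++ drop i w ++ C ≡ closure w
    split≡ = trans (sym (++-assoc (take i w) (drop i w) C)) (cong (_++ C) (take++drop≡id i w))
    -- the closure read backwards is take i w ++ reverse w
    tail≡ : drop i w ++ C ≡ reverse w
    tail≡ = ++-cancelˡ (take i w) _ _
      (trans split≡ (trans (sym (closure-palindrome w)) (reverse-++-reverse w (take i w))))
    closure≡ : take i w ++ (b ∷ m) ++ C ≡ closure w
    closure≡ = trans (cong (λ v → take i w ++ v ++ C) (sym drop≡)) split≡

  closure-ψʳ-decomposition : ∀ a u c → ∃[ q ]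
    closure (a ∷ ψʳ a u ∷ʳ c) ≡ a ∷ ψʳ a q × Palindrome q × IsPrefix (u ∷ʳ c) q
  closure-ψʳ-decomposition a u c = q , closure≡ , palindrome , prefix
    where
    w = a ∷ ψʳ a u ∷ʳ c
    pal = closure-palindrome w
    image = everyOther⇒ψʳ-image a _
      (closure-everyOther a (a ∷ ψʳ a u) c (everyOther-ψʳ a u c))
      (palindrome-∷-emptyOrEndsWith a _ pal)
    q = proj₁ image
    closure≡ : closure w ≡ a ∷ ψʳ a q
    closure≡ = cong (a ∷_) (proj₂ image)
    palindrome : Palindrome q
    palindrome = ψʳ-palindrome⁻ a q (subst Palindrome closure≡ pal)
    prefix : IsPrefix (u ∷ʳ c) q
    prefix = ψʳ-isPrefix⁻ a u c q (_ , proj₂ image)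

  closure-ψʳ : ∀ a u c → closure (a ∷ ψʳ a u ∷ʳ c) ≡ a ∷ ψʳ a (closure (u ∷ʳ c))
  closure-ψʳ a u c = closure-unique w (a ∷ ψʳ a p) (palindrome , prefix , minimal)
    where
    w = a ∷ ψʳ a u ∷ʳ c
    p = closure (u ∷ʳ c)
    palindrome : Palindrome (a ∷ ψʳ a p)
    palindrome = ψʳ-palindrome a p (closure-palindrome (u ∷ʳ c))
    prefix : IsPrefix w (a ∷ ψʳ a p)
    prefix = let t , eq = ψʳ-isPrefix a u c p (_ , refl) in t , cong (a ∷_) eq
    minimal : ∀ r → Palindrome r → IsPrefix w r → length (a ∷ ψʳ a p) ≤ length r
    minimal r pal pre =
      let q , closure≡ , palq , preq = closure-ψʳ-decomposition a u c
      in ≤-trans (s≤s (closure-minimal-ψʳ a (u ∷ʳ c) q palq preq))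
                 (subst (_≤ length r) (cong length closure≡) (closure-minimal w r pal pre))

  -- pal x n = Pal(x₁ ⋯ xₙ), the (n+1)-st palindromic prefix of the word directed by x
  pal : (ℕ → Fin k) → ℕ → Word
  pal x zero    = []
  pal x (suc n) = closure (pal x n ∷ʳ x (suc n))

  closure-[_] : ∀ c → closure [ c ] ≡ [ c ]
  closure-[ c ] = closure-unique [ c ] [ c ] (refl , ([] , refl) , λ { _ _ (_ , refl) → s≤s z≤n })

  pal-palindrome : ∀ (x : ℕ → Fin k) n → Palindrome (pal x n)
  pal-palindrome x zero    = refl
  pal-palindrome x (suc n) = closure-palindrome (pal x n ∷ʳ x (suc n))

  pal-suc-ψ : ∀ (x : ℕ → Fin k) n → pal x (suc n) ≡ ψ (x 1) (pal (x ∘ suc) n) ∷ʳ x 1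
  pal-suc-ψ x zero    = closure-[ x 1 ]
  pal-suc-ψ x (suc n) = begin
    closure (pal x (suc n) ∷ʳ c)
                          ≡⟨ cong (λ w → closure (w ∷ʳ c)) (trans (pal-suc-ψ x n) (ψ-∷ʳ a p)) ⟩
    closure (a ∷ ψʳ a p ∷ʳ c)         ≡⟨ closure-ψʳ a p c ⟩
    a ∷ ψʳ a (pal (x ∘ suc) (suc n))  ≡⟨ ψ-∷ʳ a (pal (x ∘ suc) (suc n)) ⟨
    ψ a (pal (x ∘ suc) (suc n)) ∷ʳ a  ∎
    where
    open ≡-Reasoning
    a = x 1
    c = x (suc (suc n))
    p = pal (x ∘ suc) n

  μ-suc : ∀ (x : ℕ → Fin k) n w → μ x (suc n) w ≡ ψ (x 1) (μ (x ∘ suc) n w)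
  μ-suc x zero    w = refl
  μ-suc x (suc n) w = μ-suc x n (ψ (x (suc (suc n))) w)

  μ-++ : ∀ (x : ℕ → Fin k) n u v → μ x n (u ++ v) ≡ μ x n u ++ μ x n v
  μ-++ x zero    u v = refl
  μ-++ x (suc n) u v = trans (cong (μ x n) (ψ-++ (x (suc n)) u v)) (μ-++ x n _ _)

  pal-suc : ∀ (x : ℕ → Fin k) n → pal x (suc n) ≡ h x n ++ pal x n
  pal-suc x zero    = closure-[ x 1 ]
  pal-suc x (suc n) = begin
    pal x (suc (suc n))                              ≡⟨ pal-suc-ψ x (suc n) ⟩
    ψ a (pal (x ∘ suc) (suc n)) ∷ʳ a                 ≡⟨ cong (λ w → ψ a w ∷ʳ a) (pal-suc (x ∘ suc) n) ⟩
    ψ a (h (x ∘ suc) n ++ pal (x ∘ suc) n) ∷ʳ a      ≡⟨ cong (_∷ʳ a) (ψ-++ a (h (x ∘ suc) n) _) ⟩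
    (ψ a (h (x ∘ suc) n) ++ ψ a (pal (x ∘ suc) n)) ∷ʳ a
                                                     ≡⟨ ++-assoc (ψ a (h (x ∘ suc) n)) _ _ ⟩
    ψ a (h (x ∘ suc) n) ++ (ψ a (pal (x ∘ suc) n) ∷ʳ a)
                                                     ≡⟨ cong₂ _++_ (μ-suc x n _) (pal-suc-ψ x n) ⟨
    h x (suc n) ++ pal x (suc n)                     ∎
    where
    open ≡-Reasoning
    a = x 1

  pal-suc-reverse : ∀ (x : ℕ → Fin k) n → pal x (suc n) ≡ pal x n ++ reverse (h x n)
  pal-suc-reverse x n = begin
    pal x (suc n)                  ≡⟨ pal-palindrome x (suc n) ⟨
    reverse (pal x (suc n))        ≡⟨ cong reverse (pal-suc x n) ⟩
    reverse (h x n ++ pal x n)     ≡⟨ reverse-++ (h x n) (pal x n) ⟩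
    reverse (pal x n) ++ reverse (h x n) ≡⟨ cong (_++ reverse (h x n)) (pal-palindrome x n) ⟩
    pal x n ++ reverse (h x n)     ∎
    where open ≡-Reasoning

  length-h≤ : ∀ (x : ℕ → Fin k) n → length (h x n) ≤ suc (length (pal x n))
  length-h≤ x n = +-cancelʳ-≤ (length p) _ _ (begin
    length (h x n) + length p       ≡⟨ length-++ (h x n) ⟨
    length (h x n ++ p)             ≡⟨ cong length (pal-suc x n) ⟨
    length (pal x (suc n))          ≤⟨ closure-minimal (p ∷ʳ c) ((p ∷ʳ c) ++ reverse p)
                                         (∷ʳ-++-reverse-palindrome p c) (reverse p , refl) ⟩
    length ((p ∷ʳ c) ++ reverse p)  ≡⟨ length-++ (p ∷ʳ c) ⟩
    length (p ∷ʳ c) + length (reverse p) ≡⟨ cong₂ _+_ (length-∷ʳ p c) (length-reverse p) ⟩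
    suc (length p) + length p       ∎)
    where
    open ≤-Reasoning
    p = pal x n
    c = x (suc n)

  ψ-[_] : ∀ (a : Fin k) → ψ a [ a ] ≡ [ a ]
  ψ-[ a ] with a ≟ a
  ... | yes _   = refl
  ... | no a≢a = ⊥-elim (a≢a refl)

  h-constant : ∀ (x : ℕ → Fin k) n → x (suc n) ≡ x (suc (suc n)) → h x (suc n) ≡ h x n
  h-constant x n x≡ = begin
    μ x n (ψ (x (suc n)) [ x (suc (suc n)) ])  ≡⟨ cong (λ c → μ x n (ψ (x (suc n)) [ c ])) x≡ ⟨
    μ x n (ψ (x (suc n)) [ x (suc n) ])        ≡⟨ cong (μ x n) ψ-[ x (suc n) ] ⟩
    μ x n [ x (suc n) ]                        ∎
    where open ≡-Reasoning

  ψ-letter-∷ʳ : ∀ (b c : Fin k) → ∃[ p ] ψ b [ c ] ≡ p ∷ʳ c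
  ψ-letter-∷ʳ b c with b ≟ c
  ... | yes _ = [] , refl
  ... | no  _ = [ b ] , refl

  μ-∷ʳ : ∀ (x : ℕ → Fin k) n c → ∃[ p ] μ x n [ c ] ≡ p ∷ʳ c
  μ-∷ʳ x zero    c = [] , refl
  μ-∷ʳ x (suc n) c with p , ψ≡ ← ψ-letter-∷ʳ (x (suc n)) c | p′ , μ≡ ← μ-∷ʳ x n c =
    μ x n p ++ p′ , (begin
    μ x n (ψ (x (suc n)) [ c ])   ≡⟨ cong (μ x n) ψ≡ ⟩
    μ x n (p ∷ʳ c)                ≡⟨ μ-++ x n p [ c ] ⟩
    μ x n p ++ μ x n [ c ]        ≡⟨ cong (μ x n p ++_) μ≡ ⟩
    μ x n p ++ p′ ∷ʳ c            ≡⟨ ++-assoc (μ x n p) p′ [ c ] ⟨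
    (μ x n p ++ p′) ∷ʳ c          ∎)
    where open ≡-Reasoning

  reverse-h : ∀ (x : ℕ → Fin k) n → ∃[ t ] reverse (h x n) ≡ x (suc n) ∷ t
  reverse-h x n with p , μ≡ ← μ-∷ʳ x n (x (suc n)) =
    reverse p , trans (cong reverse μ≡) (reverse-++ p [ x (suc n) ])

  count : Fin k → Word → ℕ
  count b w = length (filter (b ≟_) w)

  count-++ : ∀ b u v → count b (u ++ v) ≡ count b u + count b v
  count-++ b u v = trans (cong length (filter-++ (b ≟_) u v)) (length-++ (filter (b ≟_) u))

  count-∷-≢ : ∀ a b w → ¬ a ≡ b → count b (a ∷ w) ≡ count b w
  count-∷-≢ a b w a≢b = cong length (filter-reject (b ≟_) (λ b≡a → a≢b (sym b≡a)))

  count-∷ʳ : ∀ b w → count b (w ∷ʳ b) ≡ suc (count b w)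
  count-∷ʳ b w = trans (count-++ b w [ b ])
    (trans (cong (λ n → count b w + length n) (filter-accept (b ≟_) refl)) (+-comm (count b w) 1))

  -- V = hh V₀ = V₀ e: the word V has period |hh| = |e|.
  module Periodic {hh V₀ e V : Word} (V≡hh++ : V ≡ hh ++ V₀) (V≡++e : V ≡ V₀ ++ e)
                  (hh≡e : length hh ≡ length e) where

    take-drop-period : ∀ q n → q + n ≤ length V₀ → take n (drop (length hh + q) V) ≡ take n (drop q V)
    take-drop-period q n q+n≤ = begin
      take n (drop (length hh + q) V)          ≡⟨ cong (take n) (drop-drop (length hh) q V) ⟨
      take n (drop q (drop (length hh) V))     ≡⟨ cong (λ v → take n (drop q (drop (length hh) v))) V≡hh++ ⟩
      take n (drop q (drop (length hh) (hh ++ V₀))) ≡⟨ cong (take n ∘ drop q) (drop-length-++ hh V₀) ⟩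
      take n (drop q V₀)                       ≡⟨ take-drop-++-≤ q n V₀ e q+n≤ ⟨
      take n (drop q (V₀ ++ e))                ≡⟨ cong (take n ∘ drop q) V≡++e ⟨
      take n (drop q V)                        ∎
      where open ≡-Reasoning

    window : ℕ → Word
    window q = take (length hh) (drop q V)

    -- A window and its successor differ by a letter leaving and, by periodicity, the same letter entering.
    count-window-suc : ∀ b q → suc q ≤ length V₀ → count b (window q) ≡ count b (window (suc q))
    count-window-suc b q q<V₀ = +-cancelˡ-≡ (count b leaving) _ _ (begin
      count b leaving + count b (window q)    ≡⟨ +-comm (count b leaving) _ ⟩
      count b (window q) + count b leaving
                                   ≡⟨ cong (λ w → count b (window q) + count b w) entering≡leaving ⟨
      count b (window q) + count b entering   ≡⟨ count-++ b (window q) entering ⟨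
      count b (window q ++ entering)          ≡⟨ cong (count b) (take-+ (length hh) 1 (drop q V)) ⟨
      count b (take (length hh + 1) (drop q V))
                                   ≡⟨ cong (λ n → count b (take n (drop q V))) (+-comm (length hh) 1) ⟩
      count b (take (1 + length hh) (drop q V)) ≡⟨ cong (count b) (take-+ 1 (length hh) (drop q V)) ⟩
      count b (leaving ++ take (length hh) (drop 1 (drop q V)))
                                              ≡⟨ cong (λ v → count b (leaving ++ take (length hh) v)) drop-suc ⟩
      count b (leaving ++ window (suc q))     ≡⟨ count-++ b leaving (window (suc q)) ⟩
      count b leaving + count b (window (suc q)) ∎)
      where
      open ≡-Reasoning
      leaving = take 1 (drop q V)
      entering = take 1 (drop (length hh) (drop q V))
      drop-suc : drop 1 (drop q V) ≡ drop (suc q) V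
      drop-suc = trans (drop-drop q 1 V) (cong (λ i → drop i V) (+-comm q 1))
      entering≡leaving : entering ≡ leaving
      entering≡leaving = trans (cong (take 1) (drop-drop q (length hh) V))
        (trans (cong (λ i → take 1 (drop i V)) (+-comm q (length hh)))
          (take-drop-period q 1 (subst (_≤ length V₀) (+-comm 1 q) q<V₀)))

    count-window : ∀ b r q → r + q ≡ length V₀ → count b (window q) ≡ count b e
    count-window b zero    q refl = cong (count b) (begin
      take (length hh) (drop (length V₀) V)         ≡⟨ cong (take (length hh) ∘ drop (length V₀)) V≡++e ⟩
      take (length hh) (drop (length V₀) (V₀ ++ e)) ≡⟨ cong (take (length hh)) (drop-length-++ V₀ e) ⟩
      take (length hh) e                            ≡⟨ take-all (length hh) e (≤-reflexive (sym hh≡e)) ⟩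
      e                                             ∎)
      where open ≡-Reasoning
    count-window b (suc r) q r+q≡ =
      trans (count-window-suc b q (subst (suc q ≤_) r+q≡ (s≤s (m≤n+m q r))))
            (count-window b r (suc q) (trans (+-suc r q) r+q≡))

    occurrence-shift : ∀ {w N p} → length hh ≤ p → Occ w (take N V) p → Occ w (take N V) (p ∸ length hh)
    occurrence-shift {w} {N} {p} hh≤p (p+w≤ , occurs) =
      ≤-trans (+-monoˡ-≤ (length w) (m∸n≤m p (length hh))) p+w≤ , shifted
      where
      q = p ∸ length hh
      p+w≤N : p + length w ≤ N
      p+w≤N = ≤-trans p+w≤ (length-take≤n N V)
      q+w≤N : q + length w ≤ N
      q+w≤N = ≤-trans (+-monoˡ-≤ (length w) (m∸n≤m p (length hh))) p+w≤N
      q+w≤V₀ : q + length w ≤ length V₀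
      q+w≤V₀ = +-cancelˡ-≤ (length hh) _ _ (begin
        length hh + (q + length w)   ≡⟨ +-assoc (length hh) q (length w) ⟨
        length hh + q + length w     ≡⟨ cong (_+ length w) (m+[n∸m]≡n hh≤p) ⟩
        p + length w                 ≤⟨ ≤-trans p+w≤ (length-take≤ N V) ⟩
        length V                     ≡⟨ cong length V≡hh++ ⟩
        length (hh ++ V₀)            ≡⟨ length-++ hh ⟩
        length hh + length V₀        ∎)
        where open ≤-Reasoning
      shifted : take (length w) (drop q (take N V)) ≡ w
      shifted = begin
        take (length w) (drop q (take N V))  ≡⟨ take-drop-take q (length w) N V q+w≤N ⟩
        take (length w) (drop q V)           ≡⟨ take-drop-period q (length w) q+w≤V₀ ⟨
        take (length w) (drop (length hh + q) V)
                                             ≡⟨ cong (λ i → take (length w) (drop i V)) (m+[n∸m]≡n hh≤p) ⟩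
        take (length w) (drop p V)           ≡⟨ take-drop-take p (length w) N V p+w≤N ⟨
        take (length w) (drop p (take N V))  ≡⟨ occurs ⟩
        w                                    ∎
        where open ≡-Reasoning

  -- Every window of length |a t| starting at or before |V₀| contains as many b's as the last one,
  -- a t, whereas t b contains one more.
  periodic-no-occurrence : ∀ {hh V₀ a t V} b → ¬ a ≡ b →
    V ≡ hh ++ V₀ → V ≡ V₀ ++ a ∷ t → length hh ≡ suc (length t) →
    ∀ q → q ≤ length V₀ → ¬ take (length (t ∷ʳ b)) (drop q V) ≡ t ∷ʳ b
  periodic-no-occurrence {hh} {V₀} {a} {t} {V} b a≢b V≡hh++ V≡++e hh≡ q q≤ occurs =
    1+n≢n (begin
      suc (count b t)                               ≡⟨ count-∷ʳ b t ⟨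
      count b (t ∷ʳ b)                              ≡⟨ cong (count b) occurs ⟨
      count b (take (length (t ∷ʳ b)) (drop q V))   ≡⟨ cong (λ n → count b (take n (drop q V))) tb≡hh ⟩
      count b (window q)                            ≡⟨ count-window b (length V₀ ∸ q) q (m∸n+n≡m q≤) ⟩
      count b (a ∷ t)                               ≡⟨ count-∷-≢ a b t a≢b ⟩
      count b t                                     ∎)
    where
    open ≡-Reasoning
    open Periodic {hh} {V₀} {a ∷ t} {V} V≡hh++ V≡++e hh≡
    tb≡hh : length (t ∷ʳ b) ≡ length hh
    tb≡hh = trans (length-∷ʳ t b) (sym hh≡)

  -- T ends with t (as |U| ≤ |V₀|), so an occurrence of T b before position |U a| would contain
  -- an occurrence of t b within the periodic part.
  no-early-occurrence : ∀ {hh V₀ U T a t V} b → ¬ a ≡ b →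
    V ≡ hh ++ V₀ → V ≡ V₀ ++ a ∷ t → length hh ≡ suc (length t) →
    V ≡ U ++ a ∷ T → length U ≤ length V₀ →
    ∀ j → j ≤ length U → ¬ Occ (T ∷ʳ b) (V ∷ʳ b) j
  no-early-occurrence {V₀ = V₀} {U} {T} {a} {t} {V} b a≢b V≡hh++ V≡++e hh≡ V≡U++ U≤V₀ j j≤U (_ , occurs) =
    periodic-no-occurrence b a≢b V≡hh++ V≡++e hh≡ (j + length M) j+M≤V₀
      (take-drop-++ʳ j M (t ∷ʳ b) V (subst (λ w → take (length w) (drop j V) ≡ w) Tb≡ occurs-in-V))
    where
    split = ++-split (U ∷ʳ a) T (V₀ ∷ʳ a) t
      (trans (∷ʳ-++ U a T) (trans (sym V≡U++) (trans V≡++e (sym (∷ʳ-++ V₀ a t)))))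
      (subst₂ _≤_ (sym (length-∷ʳ U a)) (sym (length-∷ʳ V₀ a)) (s≤s U≤V₀))
    M = proj₁ split
    Tb≡ : T ∷ʳ b ≡ M ++ t ∷ʳ b
    Tb≡ = trans (cong (_∷ʳ b) (proj₂ (proj₂ split))) (++-assoc M t [ b ])
    V₀≡ : length V₀ ≡ length U + length M
    V₀≡ = suc-injective (begin
      suc (length V₀)            ≡⟨ length-∷ʳ V₀ a ⟨
      length (V₀ ∷ʳ a)           ≡⟨ cong length (proj₁ (proj₂ split)) ⟩
      length ((U ∷ʳ a) ++ M)     ≡⟨ length-++ (U ∷ʳ a) ⟩
      length (U ∷ʳ a) + length M ≡⟨ cong (_+ length M) (length-∷ʳ U a) ⟩
      suc (length U + length M)  ∎)
      where open ≡-Reasoning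
    j+M≤V₀ : j + length M ≤ length V₀
    j+M≤V₀ = subst (j + length M ≤_) (sym V₀≡) (+-monoˡ-≤ (length M) j≤U)
    j+Tb≤V : j + length (T ∷ʳ b) ≤ length V
    j+Tb≤V = subst₂ (λ m n → j + m ≤ n) (sym (length-∷ʳ T b))
      (sym (trans (cong length V≡U++) (length-++ U))) (+-monoˡ-≤ (suc (length T)) j≤U)
    occurs-in-V : take (length (T ∷ʳ b)) (drop j V) ≡ T ∷ʳ b
    occurs-in-V = trans (sym (take-drop-++-≤ j _ V [ b ] j+Tb≤V)) occurs

  length-pref : ∀ n (s : InfWord k) → length (pref n s) ≡ n
  length-pref zero    s = refl
  length-pref (suc n) s = cong suc (length-pref n (s ∘ suc))

  pref-+ : ∀ m n (s : InfWord k) → pref (m + n) s ≡ pref m s ++ pref n (shift m s)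
  pref-+ zero    n s = refl
  pref-+ (suc m) n s = cong (s 0 ∷_) (pref-+ m n (s ∘ suc))

  pref-take : ∀ m n (s : InfWord k) → m ≤ n → pref m s ≡ take m (pref n s)
  pref-take zero    n       s _        = refl
  pref-take (suc m) (suc n) s (s≤s m≤n) = cong (s 0 ∷_) (pref-take m n (s ∘ suc) m≤n)

  pref-++ˡ : ∀ (s : InfWord k) u v → pref (length (u ++ v)) s ≡ u ++ v → pref (length u) s ≡ u
  pref-++ˡ s u v uv-prefix = trans (pref-take (length u) _ s (length-++-≤ˡ u))
    (trans (cong (take (length u)) uv-prefix) (take-length-++ u v))

  occ-++ : ∀ (u w : Word) → Occ w (u ++ w) (length u)
  occ-++ u w = ≤-reflexive (sym (length-++ u)) ,
               trans (cong (take (length w)) (drop-length-++ u w)) (take-all (length w) w ≤-refl)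

  occ-++-≤ : ∀ (u w : Word) j → Occ w (u ++ w) j → j ≤ length u
  occ-++-≤ u w j (j+w≤ , _) =
    +-cancelʳ-≤ (length w) j (length u) (subst (j + length w ≤_) (length-++ u) j+w≤)

  occurs-twice : ∀ {w v : Word} {i j} → Occ w v i → Occ w v j → ¬ i ≡ j → ¬ OccursOnce w v
  occurs-twice occᵢ occⱼ i≢j (_ , _ , unique) = i≢j (trans (unique _ occᵢ) (sym (unique _ occⱼ)))

  directive⇒pal-prefix : ∀ {s : InfWord k} {x} → DirectiveWord s x →
                         ∀ n → pref (length (pal x n)) s ≡ pal x n
  directive⇒pal-prefix {s} {x} (u , u₁≡[] , u-closure , u-prefix , _) n =
    subst (λ w → pref (length w) s ≡ w) (u≡pal n) (u-prefix (suc n) (s≤s z≤n))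
    where
    u≡pal : ∀ n → u (suc n) ≡ pal x n
    u≡pal zero    = u₁≡[]
    u≡pal (suc n) = sym (closure-unique _ _
      (subst (λ w → IsPalClosure (w ∷ʳ x (suc n)) (u (suc (suc n)))) (u≡pal n) (u-closure (suc n) (s≤s z≤n))))

module ZivLempel {k : ℕ} (s : InfWord k) (x y : ℕ → Fin k) (d : ℕ → ℕ)
  (pal-prefix : ∀ n → pref (length (pal x n)) s ≡ pal x n)
  (d-positive : ∀ i → 1 ≤ i → 1 ≤ d i)
  (y-alternates : ∀ i → 1 ≤ i → ¬ y i ≡ y (suc i))
  (x-blocks : ∀ m j → 1 ≤ m → g d m ≤ j → j < g d (suc m) → x j ≡ y m) where

  private
    Word = List (Fin k)

  -- The (i+1)-st block y_{i+1}^{d_{i+1}} of the directive word occupies the positions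
  -- start i + 1, …, start i + d (i+1), where start i = d₁ + ⋯ + dᵢ = g (i+1) − 1.
  start : ℕ → ℕ
  start i = dsum d (suc i)

  x-block : ∀ i t → 1 ≤ t → t ≤ d (suc i) → x (start i + t) ≡ y (suc i)
  x-block i t 1≤t t≤d = x-blocks (suc i) (start i + t) (s≤s z≤n) (+-monoʳ-≤ (start i) 1≤t)
    (subst (suc (start i + t) ≤_) (+-comm 1 (start i + d (suc i))) (s≤s (+-monoʳ-≤ (start i) t≤d)))

  x-block-first : ∀ i → x (suc (start i)) ≡ y (suc i)
  x-block-first i = subst (λ j → x j ≡ y (suc i)) (+-comm (start i) 1)
    (x-block i 1 ≤-refl (d-positive (suc i) (s≤s z≤n)))

  h-block : ∀ i t → t < d (suc i) → h x (start i + t) ≡ h x (start i)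
  h-block i zero    _   = cong (h x) (+-identityʳ (start i))
  h-block i (suc t) t<d = trans (cong (h x) (+-suc (start i) t))
    (trans (h-constant x (start i + t) (trans xₜ (sym xₜ₊₁))) (h-block i t (<⇒≤ t<d)))
    where
    xₜ : x (suc (start i + t)) ≡ y (suc i)
    xₜ = subst (λ j → x j ≡ y (suc i)) (+-suc (start i) t) (x-block i (suc t) (s≤s z≤n) (<⇒≤ t<d))
    xₜ₊₁ : x (suc (suc (start i + t))) ≡ y (suc i)
    xₜ₊₁ = subst (λ j → x j ≡ y (suc i)) (trans (+-suc (start i) (suc t)) (cong suc (+-suc (start i) t)))
                 (x-block i (suc (suc t)) (s≤s z≤n) t<d)

  -- H i = h̄_{g(i+1)−1}, repeated d (i+1) times along block i+1
  H : ℕ → Word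
  H i = reverse (h x (start i))

  H-head : ∀ i → H i ≡ y (suc i) ∷ drop 1 (H i)
  H-head i = let t , H≡ = reverse-h x (start i) in ∷-drop-1 (trans H≡ (cong (_∷ t) (x-block-first i)))

  pal-block : ∀ i t → t ≤ d (suc i) → pal x (start i + t) ≡ pal x (start i) ++ H i ^ t
  pal-block i zero    _   = trans (cong (pal x) (+-identityʳ (start i))) (sym (++-identityʳ _))
  pal-block i (suc t) t<d = begin
    pal x (start i + suc t)                    ≡⟨ cong (pal x) (+-suc (start i) t) ⟩
    pal x (suc (start i + t))                  ≡⟨ pal-suc-reverse x (start i + t) ⟩
    pal x (start i + t) ++ reverse (h x (start i + t))
                        ≡⟨ cong₂ (λ u v → u ++ reverse v) (pal-block i t (<⇒≤ t<d)) (h-block i t t<d) ⟩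
    (pal x (start i) ++ H i ^ t) ++ H i        ≡⟨ ++-assoc (pal x (start i)) (H i ^ t) (H i) ⟩
    pal x (start i) ++ (H i ^ t ++ H i)        ≡⟨ cong (pal x (start i) ++_) (^-suc (H i) t) ⟩
    pal x (start i) ++ H i ^ suc t             ∎
    where open ≡-Reasoning

  -- Writing d (i+1) = D′ + 1, the last step of block i+1 shows that V = pal x (start (i+1))
  -- has period |h_{start i}|.
  module Block (i : ℕ) where

    D′ : ℕ
    D′ = pred (d (suc i))

    d≡ : d (suc i) ≡ suc D′
    d≡ = sym (suc-pred (d (suc i)) {{>-nonZero (d-positive (suc i) (s≤s z≤n))}})

    U V V₀ T : Word
    U  = pal x (start i)
    V  = pal x (start (suc i))
    V₀ = pal x (start i + D′)
    T  = drop 1 (H i ^ d (suc i))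

    D′<d : D′ < d (suc i)
    D′<d = subst (D′ <_) (sym d≡) ≤-refl

    V≡pal-suc : V ≡ pal x (suc (start i + D′))
    V≡pal-suc = trans (cong (λ t → pal x (start i + t)) d≡) (cong (pal x) (+-suc (start i) D′))

    V≡h++V₀ : V ≡ h x (start i) ++ V₀
    V≡h++V₀ = trans V≡pal-suc
      (trans (pal-suc x (start i + D′)) (cong (_++ V₀) (h-block i D′ D′<d)))

    V≡V₀++H : V ≡ V₀ ++ y (suc i) ∷ drop 1 (H i)
    V≡V₀++H = trans V≡pal-suc (trans (pal-suc-reverse x (start i + D′))
      (cong (V₀ ++_) (trans (cong reverse (h-block i D′ D′<d)) (H-head i))))

    length-h : length (h x (start i)) ≡ suc (length (drop 1 (H i)))
    length-h = trans (sym (length-reverse (h x (start i)))) (cong length (H-head i))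

    H^d≡ : H i ^ d (suc i) ≡ y (suc i) ∷ T
    H^d≡ = ∷-drop-1 (begin
      H i ^ d (suc i)                            ≡⟨ cong (H i ^_) d≡ ⟩
      H i ++ H i ^ D′                            ≡⟨ cong (_++ H i ^ D′) (H-head i) ⟩
      y (suc i) ∷ drop 1 (H i) ++ H i ^ D′       ∎)
      where open ≡-Reasoning

    V≡U++ : V ≡ U ++ y (suc i) ∷ T
    V≡U++ = trans (pal-block i (d (suc i)) ≤-refl) (cong (U ++_) H^d≡)

    U≤V₀ : length U ≤ length V₀
    U≤V₀ = subst (λ w → length U ≤ length w) (sym (pal-block i D′ (<⇒≤ D′<d))) (length-++-≤ˡ U)

  -- Π i = z₁ ⋯ zᵢ
  Π : ℕ → Word
  Π zero    = []
  Π (suc i) = pal x (start i) ∷ʳ y (suc i)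

  z : ℕ → Word
  z zero          = []
  z (suc zero)    = [ x 1 ]
  z (suc (suc i)) = drop 1 (H i ^ d (suc i)) ∷ʳ y (suc (suc i))

  Π-suc : ∀ i → Π (suc i) ≡ Π i ++ z (suc i)
  Π-suc zero    = cong [_] (sym (x-block-first 0))
  Π-suc (suc i) = trans (cong (_∷ʳ y (suc (suc i))) V≡U++)
    (trans (++-assoc U (y (suc i) ∷ T) _) (sym (++-assoc U [ y (suc i) ] (T ∷ʳ y (suc (suc i))))))
    where open Block i

  pos-z : ∀ i → pos z (suc i) ≡ length (Π i)
  pos-z zero    = refl
  pos-z (suc i) = trans (cong (_+ length (z (suc i))) (pos-z i))
    (trans (sym (length-++ (Π i))) (cong length (sym (Π-suc i))))

  Π-prefix : ∀ i → pref (length (Π i)) s ≡ Π i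
  Π-prefix zero    = refl
  Π-prefix (suc i) = pref-++ˡ s (Π (suc i)) (drop 1 (H i))
    (subst (λ w → pref (length w) s ≡ w) pal≡ (pal-prefix (suc (start i))))
    where
    pal≡ : pal x (suc (start i)) ≡ Π (suc i) ++ drop 1 (H i)
    pal≡ = trans (pal-suc-reverse x (start i))
      (trans (cong (pal x (start i) ++_) (H-head i)) (sym (∷ʳ-++ (pal x (start i)) (y (suc i)) _)))

  prefix-z : ∀ i → pref (length (Π i) + length (z (suc i))) s ≡ Π i ++ z (suc i)
  prefix-z i = trans (cong (λ n → pref n s) (sym (length-++ (Π i))))
    (subst (λ w → pref (length w) s ≡ w) (Π-suc i) (Π-prefix (suc i)))

  z-nonempty : ∀ i → 1 ≤ length (z (suc i))
  z-nonempty zero    = s≤s z≤n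
  z-nonempty (suc i) = subst (1 ≤_) (sym (length-∷ʳ (drop 1 (H i ^ d (suc i))) _)) (s≤s z≤n)

  z-factor : ∀ i → z (suc i) ≡ pref (length (z (suc i))) (shift (length (Π i)) s)
  z-factor i = ++-cancelˡ (Π i) _ _ (trans (sym (prefix-z i))
    (trans (pref-+ (length (Π i)) _ s) (cong (_++ suffix) (Π-prefix i))))
    where suffix = pref (length (z (suc i))) (shift (length (Π i)) s)

  z-no-early-occurrence : ∀ i j → j < length (Π i) → ¬ Occ (z (suc i)) (Π i ++ z (suc i)) j
  z-no-early-occurrence (suc i) j j<p occurs =
    no-early-occurrence (y (suc (suc i))) (y-alternates (suc i) (s≤s z≤n))
      V≡h++V₀ V≡V₀++H length-h V≡U++ U≤V₀ j
      (≤-pred (subst (j <_) (length-∷ʳ U (y (suc i))) j<p))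
      (subst (λ w → Occ (z (suc (suc i))) w j) (sym (Π-suc (suc i))) occurs)
    where open Block i

  z-occurs-once : ∀ i → OccursOnce (z (suc i)) (pref (length (Π i) + length (z (suc i))) s)
  z-occurs-once i = subst (OccursOnce (z (suc i))) (sym (prefix-z i))
    (length (Π i) , occ-++ (Π i) (z (suc i)) , unique)
    where
    unique : ∀ j → Occ (z (suc i)) (Π i ++ z (suc i)) j → j ≡ length (Π i)
    unique j occurs = ≤-antisym (occ-++-≤ (Π i) (z (suc i)) j occurs)
      (≮⇒≥ (λ j<p → z-no-early-occurrence i j j<p occurs))

  -- A shorter prefix of z_{i+2} also occurs |h| positions earlier, by the period of V.
  shorter-prefixes-repeat : ∀ i ℓ′ → 1 ≤ ℓ′ → ℓ′ < length (z (suc i)) →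
    ¬ OccursOnce (pref ℓ′ (shift (length (Π i)) s)) (pref (length (Π i) + ℓ′) s)
  shorter-prefixes-repeat zero    (suc ℓ′) _ (s≤s ())
  shorter-prefixes-repeat (suc i) ℓ′       _ ℓ′<z =
    occurs-twice (subst (λ v → Occ w v p) (sym X≡) occurs-at-p)
                 (subst (λ v → Occ w v (p ∸ length hh)) (sym X≡)
                   (Periodic.occurrence-shift V≡h++V₀ V≡V₀++H length-h hh≤p occurs-at-p))
                 (<⇒≢ (∸-monoʳ-< (subst (0 <_) (sym length-h) (s≤s z≤n)) hh≤p) ∘ sym)
    where
    open Block i
    hh = h x (start i)
    p = length (Π (suc i))
    w = pref ℓ′ (shift p s)
    p≡ : p ≡ suc (length U)
    p≡ = length-∷ʳ U (y (suc i))
    hh≤p : length hh ≤ p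
    hh≤p = subst (length hh ≤_) (sym p≡) (length-h≤ x (start i))
    p+ℓ′≤V : p + ℓ′ ≤ length V
    p+ℓ′≤V = begin
      p + ℓ′                  ≡⟨ cong (_+ ℓ′) p≡ ⟩
      suc (length U) + ℓ′
                          ≤⟨ +-monoʳ-≤ (suc (length U)) (≤-pred (subst (ℓ′ <_) (length-∷ʳ T _) ℓ′<z)) ⟩
      suc (length U + length T) ≡⟨ +-suc (length U) (length T) ⟨
      length U + length (y (suc i) ∷ T) ≡⟨ length-++ U ⟨
      length (U ++ y (suc i) ∷ T) ≡⟨ cong length V≡U++ ⟨
      length V                ∎
      where open ≤-Reasoning
    X≡ : pref (p + ℓ′) s ≡ take (p + ℓ′) V
    X≡ = trans (pref-take (p + ℓ′) (length V) s p+ℓ′≤V) (cong (take (p + ℓ′)) (pal-prefix (start (suc i))))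
    occurs-at-p : Occ w (take (p + ℓ′) V) p
    occurs-at-p = subst (λ v → Occ w v p) (trans (sym (pref-+ p ℓ′ s)) X≡)
      (subst (Occ w (pref p s ++ w)) (length-pref p s) (occ-++ (pref p s) w))

  is-z-factorization : IsZFactorization s z
  is-z-factorization (suc i) _ rewrite pos-z i =
    z-nonempty i , z-factor i , z-occurs-once i , shorter-prefixes-repeat i

  z-formula : ∀ i → y (suc i) ∷ z (suc (suc i))
                  ≡ reverse (h x (g d (suc i) ∸ 1)) ^ d (suc i) ++ [ y (suc (suc i)) ]
  z-formula i = trans (cong (_∷ʳ y (suc (suc i))) (sym H^d≡))
    (cong (λ n → reverse (h x n) ^ d (suc i) ∷ʳ y (suc (suc i))) (sym (m+n∸n≡m (start i) 1)))
    where open Block i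

theorem1 : {k : ℕ} (s : InfWord k) (x : ℕ → Fin k) (y : ℕ → Fin k) (d : ℕ → ℕ) →
    StandardEpisturmian s → DirectiveWord s x →
    (∀ i → 1 ≤ i → 1 ≤ d i) →
    (∀ i → 1 ≤ i → ¬ y i ≡ y (suc i)) →
    (∀ m j → 1 ≤ m → g d m ≤ j → j < g d (suc m) → x j ≡ y m) →
    Σ (ℕ → List (Fin k)) λ z →
      IsZFactorization s z ×
      (z 1 ≡ x 1 ∷ []) ×
      (∀ i → y (suc i) ∷ z (suc (suc i))
             ≡ concat (replicate (d (suc i)) (reverse (h x (g d (suc i) ∸ 1))))
               ++ y (suc (suc i)) ∷ [])
theorem1 s x y d _ directive d-positive y-alternates x-blocks =
  z , is-z-factorization , refl , z-formula
  where
  open ZivLempel s x y d (directive⇒pal-prefix directive) d-positive y-alternates x-blocks
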